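{- Let $G$ be a Lehman graph of type $(n,3,s)$ with $k=3s-n\in\{1,-1\}$, and suppose $G$ contains a $3$-rung ladder segment $L$, with vertices labelled $b_0,b_1,b_2,w_0,w_1,w_2$ and outside neighbours $w_L,b_L,w_R,b_R$ as described in the context. If either $k=-1$ and $s>1$, or $k=1$ and $s>2$, then the four vertices $b_L,w_L,b_R,w_R$ are distinct, $w_L$ is not adjacent to $b_R$, and $w_R$ is not adjacent to $b_L$.
   Context: A bipartite graph $G$ with $n$ black and $n$ white vertices has bipartite adjacency matrix $A$ (rows indexed by black vertices, columns by white vertices, entry $1$ iff adjacent). A matrix is $r$-regular if all row and column sums equal $r$. $G$ is a Lehman graph of type $(n,r,s)$ if $A$ is $r$-regular and there is an $s$-regular $n\times n$ $(0,1)$-matrix $B$ with $AB^T=J+kI$, where $k=rs-n\in\{ -1,1,2,3,\ldots\}$, $J$ is the all-ones matrix and $I$ the identity. A $3$-rung ladder segment in a cubic bipartite graph is a $6$-vertex induced subgraph isomorphic to the cube $Q_3$ with two adjacent vertices deleted; its vertices are labelled black $b_0,b_1,b_2$ and white $w_0,w_1,w_2$, with its seven edges $b_0w_0,b_1w_1,b_2w_2,b_0w_1,b_2w_1,b_1w_0,b_1w_2$. In the cubic graph, each of $b_0,w_0,b_2,w_2$ has exactly one neighbour outside $L$: $w_L$ is the outside neighbour of $b_0$, $b_L$ that of $w_0$, $w_R$ that of $b_2$, and $b_R$ that of $w_2$. -}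

module Defs where

open import Data.Nat using (ℕ; zero; suc; _+_; _*_; _≤_)
open import Data.Fin using (Fin; zero; suc)
open import Data.Integer as ℤ using (ℤ; +_; -[1+_]; _-_)
open import Data.Product using (_×_)
open import Relation.Binary.PropositionalEquality using (_≡_; _≢_)
open import Relation.Nullary using (¬_)

Mat : ℕ → Set
Mat n = Fin n → Fin n → ℕ

sumFin : ∀ {n} → (Fin n → ℕ) → ℕ
sumFin {zero}  f = 0
sumFin {suc n} f = f zero + sumFin (λ i → f (suc i))

Is01 : ∀ {n} → Mat n → Set
Is01 A = ∀ i j → A i j ≤ 1

IsRegular : ∀ {n} → ℕ → Mat n → Set
IsRegular r A = (∀ i → sumFin (λ j → A i j) ≡ r) × (∀ j → sumFin (λ i → A i j) ≡ r)

mulT : ∀ {n} → Mat n → Mat n → Fin n → Fin n → ℕ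
mulT A B i j = sumFin (λ l → A i l * B j l)

lehmanK : ℕ → ℕ → ℕ → ℤ
lehmanK n r s = + (r * s) - + n

JkI : ∀ {n} → ℤ → Fin n → Fin n → ℤ
JkI k i j with i Data.Fin.≟ j
... | Relation.Nullary.yes _ = ℤ.+ 1 ℤ.+ k
... | Relation.Nullary.no  _ = ℤ.+ 1

AdmissibleK : ℤ → Set
AdmissibleK k = (ℤ.-1ℤ ℤ.≤ k) × (k ≢ ℤ.0ℤ)

-- G (given by its bipartite adjacency matrix A; black vertices = rows,
-- white vertices = columns, both Fin n) is a Lehman graph of type (n,r,s)
record IsLehman (n r s : ℕ) (A : Mat n) : Set where
  field
    A01     : Is01 A
    Areg    : IsRegular r A
    B       : Mat n
    B01     : Is01 B
    Breg    : IsRegular s B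
    kAdm    : AdmissibleK (lehmanK n r s)
    product : ∀ i j → + (mulT A B i j) ≡ JkI (lehmanK n r s) i j

Adj : ∀ {n} → Mat n → Fin n → Fin n → Set
Adj A b w = A b w ≡ 1

record Ladder3 {n} (A : Mat n) (b0 b1 b2 w0 w1 w2 : Fin n) : Set where
  field
    b01 : b0 ≢ b1
    b02 : b0 ≢ b2
    b12 : b1 ≢ b2
    w01 : w0 ≢ w1
    w02 : w0 ≢ w2
    w12 : w1 ≢ w2
    e00 : Adj A b0 w0
    e11 : Adj A b1 w1
    e22 : Adj A b2 w2
    e01 : Adj A b0 w1
    e21 : Adj A b2 w1
    e10 : Adj A b1 w0
    e12 : Adj A b1 w2
    n02 : ¬ Adj A b0 w2
    n20 : ¬ Adj A b2 w0

Outside : ∀ {n} → Fin n → Fin n → Fin n → Fin n → Set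
Outside x y0 y1 y2 = (x ≢ y0) × (x ≢ y1) × (x ≢ y2)

-- Since A is regular and A Bᵀ = J + kI is nonsingular (k ≠ 0 and n + k = rs ≠ 0), A is
-- injective, and from A (Bᵀ A − J − kI) = 0 one gets Aᵀ B = J + kI as well: the transpose of
-- a Lehman graph is a Lehman graph, and transposing swaps the roles of black and white
-- vertices in the ladder.  So it suffices to show wL ≢ wR and ¬ bR ~ wL.
--
-- Entry (b, j) of A Bᵀ is the sum of B j x over the three neighbours x of b; it equals 1
-- off the diagonal and 1 + k on it.  If wL = wR, the rows b0, b1, b2 force B j w1 = 1 for
-- every j ∉ {b0, b1, b2}, so s ≥ n − 3, contradicting n = 3s ∓ 1.  If bR ~ wL, the rows
-- b0, b1, bR force column w2 of B to vanish outside {b0} (k = −1) or outside {b1, bR}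
-- (k = 1), so s ≤ 1 or s ≤ 2.

module Submission where

open import Defs
open import Data.Nat using (ℕ; _<_)
open import Data.Fin using (Fin)
open import Data.Integer as ℤ using (ℤ)
open import Data.Product using (_×_; _,_)
open import Data.Sum using (_⊎_)
open import Function using (flip)
open import Relation.Binary.PropositionalEquality using (_≡_; _≢_)
open import Relation.Nullary using (¬_)

module FinSums where

  open import Data.Nat using (ℕ; zero; suc; _+_; _*_; _≤_; z≤n)
  import Data.Nat.Properties as NP
  open import Data.Fin using (Fin; zero; suc; _≟_)
  open import Data.List using (List; []; _∷_; length; map)
  import Data.Nat.ListAction as List
  open import Data.List.Membership.Propositional using (_∈_; _∉_)
  open import Data.List.Relation.Unary.All as All using (All; []; _∷_)
  open import Data.List.Relation.Unary.All.Properties using (All¬⇒¬Any)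
  open import Data.List.Relation.Unary.Any using (here; there; any?)
  open import Data.List.Relation.Unary.Unique.Propositional using (Unique; []; _∷_)
  import Algebra.Properties.Semiring.Sum NP.+-*-semiring as ℕΣ
  open import Data.Empty using (⊥-elim)
  open import Function using (_∘_)
  open import Relation.Binary.PropositionalEquality
  open import Relation.Nullary using (yes; no)

  private variable n : ℕ

  sumFin≡sum : (f : Fin n → ℕ) → sumFin f ≡ ℕΣ.sum f
  sumFin≡sum {zero}  f = refl
  sumFin≡sum {suc n} f = cong (f zero +_) (sumFin≡sum (f ∘ suc))

  sumFin-cong : {f g : Fin n → ℕ} → f ≗ g → sumFin f ≡ sumFin g
  sumFin-cong {f = f} {g} f≗g =
    trans (sumFin≡sum f) (trans (ℕΣ.sum-cong-≗ f≗g) (sym (sumFin≡sum g)))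

  sumFin-+ : (f g : Fin n → ℕ) → sumFin (λ i → f i + g i) ≡ sumFin f + sumFin g
  sumFin-+ f g = begin
    sumFin (λ i → f i + g i)   ≡⟨ sumFin≡sum (λ i → f i + g i) ⟩
    ℕΣ.sum (λ i → f i + g i)   ≡⟨ ℕΣ.∑-distrib-+ f g ⟩
    ℕΣ.sum f + ℕΣ.sum g        ≡⟨ cong₂ _+_ (sumFin≡sum f) (sumFin≡sum g) ⟨
    sumFin f + sumFin g        ∎
    where open ≡-Reasoning

  sumFin-0 : (n : ℕ) → sumFin {n} (λ _ → 0) ≡ 0
  sumFin-0 zero    = refl
  sumFin-0 (suc n) = sumFin-0 n

  sumFin-1 : (n : ℕ) → sumFin {n} (λ _ → 1) ≡ n
  sumFin-1 zero    = refl
  sumFin-1 (suc n) = cong suc (sumFin-1 n)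

  sumFin-mono-≤ : {f g : Fin n → ℕ} → (∀ i → f i ≤ g i) → sumFin f ≤ sumFin g
  sumFin-mono-≤ {zero}  f≤g = z≤n
  sumFin-mono-≤ {suc n} f≤g = NP.+-mono-≤ (f≤g zero) (sumFin-mono-≤ (f≤g ∘ suc))

  sumFin-≥⇒≗ : {f g : Fin n → ℕ} → (∀ i → f i ≤ g i) → sumFin g ≤ sumFin f → f ≗ g
  sumFin-≥⇒≗ {suc n} {f} {g} f≤g Σg≤Σf zero = NP.≤-antisym (f≤g zero) g₀≤f₀
    where
    g₀≤f₀ : g zero ≤ f zero
    g₀≤f₀ = NP.+-cancelʳ-≤ _ _ _ (NP.≤-trans Σg≤Σf (NP.+-monoʳ-≤ (f zero) (sumFin-mono-≤ (f≤g ∘ suc))))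
  sumFin-≥⇒≗ {suc n} {f} {g} f≤g Σg≤Σf (suc i) = sumFin-≥⇒≗ (f≤g ∘ suc) tail-≤ i
    where
    tail-≤ : sumFin (g ∘ suc) ≤ sumFin (f ∘ suc)
    tail-≤ = NP.+-cancelˡ-≤ (g zero) _ _ (NP.≤-trans Σg≤Σf (NP.+-monoˡ-≤ _ (f≤g zero)))

  δ : Fin n → Fin n → ℕ
  δ zero    zero    = 1
  δ zero    (suc _) = 0
  δ (suc _) zero    = 0
  δ (suc x) (suc y) = δ x y

  δ-refl : (x : Fin n) → δ x x ≡ 1
  δ-refl zero    = refl
  δ-refl (suc x) = δ-refl x

  δ-≢ : {x y : Fin n} → x ≢ y → δ x y ≡ 0
  δ-≢ {x = zero}  {zero}  x≢y = ⊥-elim (x≢y refl)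
  δ-≢ {x = zero}  {suc y} x≢y = refl
  δ-≢ {x = suc x} {zero}  x≢y = refl
  δ-≢ {x = suc x} {suc y} x≢y = δ-≢ (x≢y ∘ cong suc)

  sumFin-δ* : (x : Fin n) (h : Fin n → ℕ) → sumFin (λ j → δ x j * h j) ≡ h x
  sumFin-δ* {suc n} zero    h =
    trans (cong₂ _+_ (NP.*-identityˡ (h zero)) (sumFin-0 n)) (NP.+-identityʳ (h zero))
  sumFin-δ* {suc n} (suc x) h = sumFin-δ* x (h ∘ suc)

  occ : List (Fin n) → Fin n → ℕ
  occ []       j = 0
  occ (x ∷ xs) j = δ x j + occ xs j

  sumFin-occ* : (xs : List (Fin n)) (g : Fin n → ℕ) →
                sumFin (λ j → occ xs j * g j) ≡ List.sum (map g xs)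
  sumFin-occ* {n} [] g = sumFin-0 n
  sumFin-occ* (x ∷ xs) g = begin
    sumFin (λ j → (δ x j + occ xs j) * g j)
      ≡⟨ sumFin-cong (λ j → NP.*-distribʳ-+ (g j) (δ x j) (occ xs j)) ⟩
    sumFin (λ j → δ x j * g j + occ xs j * g j)
      ≡⟨ sumFin-+ (λ j → δ x j * g j) (λ j → occ xs j * g j) ⟩
    sumFin (λ j → δ x j * g j) + sumFin (λ j → occ xs j * g j)
      ≡⟨ cong₂ _+_ (sumFin-δ* x g) (sumFin-occ* xs g) ⟩
    g x + List.sum (map g xs) ∎
    where open ≡-Reasoning

  sumFin-occ : (xs : List (Fin n)) → sumFin (occ xs) ≡ length xs
  sumFin-occ {n} []   = sumFin-0 n
  sumFin-occ (x ∷ xs) = begin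
    sumFin (λ j → δ x j + occ xs j)  ≡⟨ sumFin-+ (δ x) (occ xs) ⟩
    sumFin (δ x) + sumFin (occ xs)   ≡⟨ cong₂ _+_ sumFin-δ (sumFin-occ xs) ⟩
    suc (length xs)                  ∎
    where
    open ≡-Reasoning
    sumFin-δ : sumFin (δ x) ≡ 1
    sumFin-δ = trans (sumFin-cong (λ j → sym (NP.*-identityʳ (δ x j)))) (sumFin-δ* x (λ _ → 1))

  occ-∉ : {j : Fin n} {xs : List (Fin n)} → j ∉ xs → occ xs j ≡ 0
  occ-∉ {xs = []}     j∉xs = refl
  occ-∉ {xs = x ∷ xs} j∉xs =
    cong₂ _+_ (δ-≢ (j∉xs ∘ here ∘ sym)) (occ-∉ (j∉xs ∘ there))

  occ-∈ : {j : Fin n} {xs : List (Fin n)} → j ∈ xs → 1 ≤ occ xs j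
  occ-∈ {j = j} (here refl)       = NP.≤-trans (NP.≤-reflexive (sym (δ-refl j))) (NP.m≤m+n _ _)
  occ-∈ {xs = x ∷ _} (there j∈xs) = NP.≤-trans (occ-∈ j∈xs) (NP.m≤n+m _ (δ x _))

  occ-unique : {xs : List (Fin n)} → Unique xs → (j : Fin n) → occ xs j ≤ 1
  occ-unique []                   j = z≤n
  occ-unique {xs = x ∷ xs} (x∉xs ∷ xs!) j with x ≟ j
  ... | yes refl = NP.≤-reflexive (cong₂ _+_ (δ-refl x) (occ-∉ (All¬⇒¬Any x∉xs)))
  ... | no x≢j   = NP.≤-trans (NP.≤-reflexive (cong (_+ occ xs j) (δ-≢ x≢j))) (occ-unique xs! j)

  sumFin-≤-length : {h : Fin n → ℕ} (xs : List (Fin n)) → (∀ j → h j ≤ 1) →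
                    (∀ j → j ∉ xs → h j ≡ 0) → sumFin h ≤ length xs
  sumFin-≤-length {h = h} xs h≤1 h-vanishes =
    NP.≤-trans (sumFin-mono-≤ h≤occ) (NP.≤-reflexive (sumFin-occ xs))
    where
    h≤occ : ∀ j → h j ≤ occ xs j
    h≤occ j with any? (j ≟_) xs
    ... | yes j∈xs = NP.≤-trans (h≤1 j) (occ-∈ j∈xs)
    ... | no  j∉xs = NP.≤-trans (NP.≤-reflexive (h-vanishes j j∉xs)) z≤n

  ≤-sumFin+length : {h : Fin n → ℕ} (xs : List (Fin n)) →
                    (∀ j → j ∉ xs → 1 ≤ h j) → n ≤ sumFin h + length xs
  ≤-sumFin+length {n} {h} xs h-positive = begin
    n                                  ≡⟨ sumFin-1 n ⟨
    sumFin {n} (λ _ → 1)               ≤⟨ sumFin-mono-≤ 1≤h+occ ⟩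
    sumFin (λ j → h j + occ xs j)      ≡⟨ sumFin-+ h (occ xs) ⟩
    sumFin h + sumFin (occ xs)         ≡⟨ cong (sumFin h +_) (sumFin-occ xs) ⟩
    sumFin h + length xs               ∎
    where
    open NP.≤-Reasoning
    1≤h+occ : ∀ j → 1 ≤ h j + occ xs j
    1≤h+occ j with any? (j ≟_) xs
    ... | yes j∈xs = NP.≤-trans (occ-∈ j∈xs) (NP.m≤n+m _ (h j))
    ... | no  j∉xs = NP.≤-trans (h-positive j j∉xs) (NP.m≤m+n (h j) _)

  occ-≤ : {f : Fin n → ℕ} {xs : List (Fin n)} → Unique xs → All (λ x → 1 ≤ f x) xs →
          ∀ j → occ xs j ≤ f j
  occ-≤ {xs = xs} xs! 1≤f j with any? (j ≟_) xs
  ... | yes j∈xs = NP.≤-trans (occ-unique xs! j) (All.lookup 1≤f j∈xs)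
  ... | no  j∉xs = NP.≤-trans (NP.≤-reflexive (occ-∉ j∉xs)) z≤n

  sumFin-*-≥ : {f : Fin n → ℕ} {xs : List (Fin n)} → Unique xs → All (λ x → 1 ≤ f x) xs →
               (g : Fin n → ℕ) → List.sum (map g xs) ≤ sumFin (λ j → f j * g j)
  sumFin-*-≥ {xs = xs} xs! 1≤f g =
    NP.≤-trans (NP.≤-reflexive (sym (sumFin-occ* xs g)))
               (sumFin-mono-≤ (λ j → NP.*-monoˡ-≤ (g j) (occ-≤ xs! 1≤f j)))

  sumFin-*-≡ : {f : Fin n → ℕ} {xs : List (Fin n)} → Unique xs → All (λ x → 1 ≤ f x) xs →
               sumFin f ≤ length xs →
               (g : Fin n → ℕ) → sumFin (λ j → f j * g j) ≡ List.sum (map g xs)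
  sumFin-*-≡ {f = f} {xs} xs! 1≤f Σf≤length g =
    trans (sumFin-cong (λ j → cong (_* g j) (sym (occ≗f j)))) (sumFin-occ* xs g)
    where
    occ≗f : occ xs ≗ f
    occ≗f = sumFin-≥⇒≗ (occ-≤ xs! 1≤f) (NP.≤-trans Σf≤length (NP.≤-reflexive (sym (sumFin-occ xs))))

module IntegerLinearAlgebra where

  open import Data.Nat as ℕ using (ℕ; zero; suc)
  open import Data.Fin using (Fin; zero; suc; punchIn; punchOut; _≟_)
  open import Data.Fin.Properties using (all?; ¬∀⟶∃¬; punchInᵢ≢i; punchIn-punchOut)
  open import Data.Integer as ℤ using (ℤ; +_; _+_; _*_; -_; _-_; 0ℤ; 1ℤ; -1ℤ)
  import Data.Integer.Properties as ZP
  open import Data.Integer.Solver using (module +-*-Solver)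
  open +-*-Solver
  open import Algebra.Properties.Semiring.Sum ZP.+-*-semiring
    using (sum; sum-syntax; sum-remove; ∑-distrib-+; ∑-comm; *-distribˡ-sum; sum-cong-≗; sum-replicate-zero)
  open import Data.Product using (_×_; _,_; ∃-syntax; Σ-syntax)
  open import Data.Sum using (inj₁; inj₂)
  open import Function using (_∘_; flip)
  open import Data.Vec.Functional using (_∷_)
  open import Relation.Binary.PropositionalEquality
  open import Relation.Nullary using (yes; no; contradiction)

  private variable m n : ℕ

  +-sumFin : (f : Fin n → ℕ) → + sumFin f ≡ ∑[ i < n ] (+ f i)
  +-sumFin {zero}  f = refl
  +-sumFin {suc n} f = trans (ZP.pos-+ (f zero) _) (cong (_+_ (+ f zero)) (+-sumFin (f ∘ suc)))

  ∑-0 : {f : Fin n → ℤ} → (∀ i → f i ≡ 0ℤ) → sum f ≡ 0ℤ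
  ∑-0 {n} f≡0 = trans (sum-cong-≗ f≡0) (sum-replicate-zero n)

  ∑-const : (n : ℕ) (x : ℤ) → ∑[ i < n ] x ≡ + n * x
  ∑-const zero    x = sym (ZP.*-zeroˡ x)
  ∑-const (suc n) x = trans (cong (_+_ x) (∑-const n x)) (sym (ZP.suc-* (+ n) x))

  ∑-sub : (f g : Fin n → ℤ) → ∑[ i < n ] (f i - g i) ≡ sum f - sum g
  ∑-sub f g = begin
    ∑[ i < _ ] (f i - g i)        ≡⟨ ∑-distrib-+ f (-_ ∘ g) ⟩
    sum f + sum (-_ ∘ g)          ≡⟨ cong (_+_ (sum f)) (sum-cong-≗ (λ i → sym (ZP.-1*i≡-i (g i)))) ⟩
    sum f + sum (λ i → -1ℤ * g i) ≡⟨ cong (_+_ (sum f)) (*-distribˡ-sum -1ℤ g) ⟨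
    sum f + -1ℤ * sum g           ≡⟨ cong (_+_ (sum f)) (ZP.-1*i≡-i (sum g)) ⟩
    sum f - sum g                 ∎
    where open ≡-Reasoning

  i≢0∧i*j≡0⇒j≡0 : {i j : ℤ} → i ≢ 0ℤ → i * j ≡ 0ℤ → j ≡ 0ℤ
  i≢0∧i*j≡0⇒j≡0 {i} i≢0 i*j≡0 with ZP.i*j≡0⇒i≡0∨j≡0 i i*j≡0
  ... | inj₁ i≡0 = contradiction i≡0 i≢0
  ... | inj₂ j≡0 = j≡0

  ∑-bilinear-comm : (c : Fin m → ℤ) (a : Fin n → ℤ) (F : Fin m → Fin n → ℤ) →
                    ∑[ i < m ] (c i * ∑[ u < n ] (a u * F i u)) ≡
                    ∑[ u < n ] (a u * ∑[ i < m ] (c i * F i u))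
  ∑-bilinear-comm {m} {n} c a F = begin
    ∑[ i < m ] (c i * ∑[ u < n ] (a u * F i u))
      ≡⟨ sum-cong-≗ (λ i → *-distribˡ-sum (c i) (λ u → a u * F i u)) ⟩
    ∑[ i < m ] ∑[ u < n ] (c i * (a u * F i u))
      ≡⟨ ∑-comm (λ i u → c i * (a u * F i u)) ⟩
    ∑[ u < n ] ∑[ i < m ] (c i * (a u * F i u))
      ≡⟨ sum-cong-≗ (λ u → sum-cong-≗ (λ i → exchange (c i) (a u) (F i u))) ⟩
    ∑[ u < n ] ∑[ i < m ] (a u * (c i * F i u))
      ≡⟨ sum-cong-≗ (λ u → *-distribˡ-sum (a u) (λ i → c i * F i u)) ⟨
    ∑[ u < n ] (a u * ∑[ i < m ] (c i * F i u)) ∎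
    where
    open ≡-Reasoning
    exchange : ∀ x y z → x * (y * z) ≡ y * (x * z)
    exchange = solve 3 (λ x y z → x :* (y :* z) := y :* (x :* z)) refl

  JkI-diagonal : (K : ℤ) (i : Fin n) → JkI K i i ≡ 1ℤ + K
  JkI-diagonal K i with i ≟ i
  ... | yes _   = refl
  ... | no  i≢i = contradiction refl i≢i

  JkI-offDiagonal : (K : ℤ) {i j : Fin n} → i ≢ j → JkI K i j ≡ 1ℤ
  JkI-offDiagonal K {i} {j} i≢j with i ≟ j
  ... | yes i≡j = contradiction i≡j i≢j
  ... | no  _   = refl

  ∑-*JkI : (K : ℤ) (r : Fin n) (g : Fin n → ℤ) → ∑[ j < n ] (g j * JkI K r j) ≡ sum g + K * g r
  ∑-*JkI {suc n} K r g = begin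
    ∑[ j < _ ] (g j * JkI K r j)
      ≡⟨ sum-remove {i = r} (λ j → g j * JkI K r j) ⟩
    g r * JkI K r r + ∑[ j < n ] (g (punchIn r j) * JkI K r (punchIn r j))
      ≡⟨ cong₂ _+_ (cong (g r *_) (JkI-diagonal K r)) (sum-cong-≗ off-diagonal) ⟩
    g r * (1ℤ + K) + ∑[ j < n ] g (punchIn r j)
      ≡⟨ solve 3 (λ x k y → x :* (con 1ℤ :+ k) :+ y := x :+ y :+ k :* x) refl (g r) K _ ⟩
    g r + ∑[ j < n ] g (punchIn r j) + K * g r
      ≡⟨ cong (_+ K * g r) (sum-remove {i = r} g) ⟨
    sum g + K * g r ∎
    where
    open ≡-Reasoning
    off-diagonal : ∀ j → g (punchIn r j) * JkI K r (punchIn r j) ≡ g (punchIn r j)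
    off-diagonal j = trans (cong (g (punchIn r j) *_) (JkI-offDiagonal K (punchInᵢ≢i r j ∘ sym)))
                           (ZP.*-identityʳ _)

  JkI-nonsingular : {K : ℤ} → K ≢ 0ℤ → + n + K ≢ 0ℤ → (c : Fin n → ℤ) →
                    (∀ r → ∑[ j < n ] (c j * JkI K r j) ≡ 0ℤ) → ∀ j → c j ≡ 0ℤ
  JkI-nonsingular {n} {K} K≢0 n+K≢0 c c[J+KI]≡0 j =
    i≢0∧i*j≡0⇒j≡0 K≢0 (trans (sym (ZP.+-identityˡ (K * c j)))
                            (trans (cong (_+ K * c j) (sym Σc≡0)) (row j)))
    where
    row : ∀ r → sum c + K * c r ≡ 0ℤ
    row r = trans (sym (∑-*JkI K r c)) (c[J+KI]≡0 r)
    Σc≡0 : sum c ≡ 0ℤ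
    Σc≡0 = i≢0∧i*j≡0⇒j≡0 n+K≢0 (begin
      (+ n + K) * sum c                        ≡⟨ ZP.*-distribʳ-+ (sum c) (+ n) K ⟩
      + n * sum c + K * sum c                  ≡⟨ cong₂ _+_ (sym (∑-const n (sum c))) (*-distribˡ-sum K c) ⟩
      ∑[ r < n ] sum c + ∑[ r < n ] (K * c r)  ≡⟨ ∑-distrib-+ (λ _ → sum c) (λ r → K * c r) ⟨
      ∑[ r < n ] (sum c + K * c r)             ≡⟨ ∑-0 row ⟩
      0ℤ                                       ∎)
      where open ≡-Reasoning

  LinearlyDependent : (Fin m → Fin n → ℤ) → Set
  LinearlyDependent {m} {n} v =
    Σ[ c ∈ (Fin m → ℤ) ] (∃[ i ] c i ≢ 0ℤ) × (∀ r → ∑[ i < m ] (c i * v i r) ≡ 0ℤ)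

  -- Gaussian elimination of coordinate r₀ from v₁, …, vₘ against the pivot entry v₀ r₀.
  eliminate : (v : Fin (suc m) → Fin (suc n) → ℤ) → Fin (suc n) → Fin m → Fin n → ℤ
  eliminate v r₀ j r = v zero r₀ * v (suc j) (punchIn r₀ r) - v (suc j) r₀ * v zero (punchIn r₀ r)

  dependent-by-pivot : (v : Fin (suc m) → Fin (suc n) → ℤ) (r₀ : Fin (suc n)) → v zero r₀ ≢ 0ℤ →
                       LinearlyDependent (eliminate v r₀) → LinearlyDependent v
  dependent-by-pivot {m} v r₀ a≢0 (c′ , (j₀ , c′j₀≢0) , c′·v′≡0) =
    c , (suc j₀ , a*c′j₀≢0) , c·v≡0
    where
    a : ℤ
    a = v zero r₀
    c : Fin (suc m) → ℤ
    c zero    = - ∑[ j < m ] (c′ j * v (suc j) r₀)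
    c (suc j) = a * c′ j

    a*c′j₀≢0 : a * c′ j₀ ≢ 0ℤ
    a*c′j₀≢0 = c′j₀≢0 ∘ i≢0∧i*j≡0⇒j≡0 a≢0

    combination : ∀ r → ∑[ i < suc m ] (c i * v i r) ≡
                        ∑[ j < m ] (c′ j * (a * v (suc j) r - v (suc j) r₀ * v zero r))
    combination r = begin
      - L * v zero r + ∑[ j < m ] (a * c′ j * v (suc j) r)
        ≡⟨ cong (_+_ (- L * v zero r)) (trans (sum-cong-≗ (λ j → ZP.*-assoc a (c′ j) _))
                                               (sym (*-distribˡ-sum a X-terms))) ⟩
      - L * v zero r + a * X
        ≡⟨ solve 4 (λ l x y z → :- l :* x :+ y :* z := y :* z :+ (:- x) :* l) refl L (v zero r) a X ⟩
      a * X + (- v zero r) * L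
        ≡⟨ cong₂ _+_ (*-distribˡ-sum a X-terms) (*-distribˡ-sum (- v zero r) L-terms) ⟩
      ∑[ j < m ] (a * X-terms j) + ∑[ j < m ] (- v zero r * L-terms j)
        ≡⟨ ∑-distrib-+ (λ j → a * X-terms j) (λ j → - v zero r * L-terms j) ⟨
      ∑[ j < m ] (a * X-terms j + - v zero r * L-terms j)
        ≡⟨ sum-cong-≗ (λ j → solve 5 (λ x y z u w → x :* (y :* z) :+ (:- w) :* (y :* u)
                                                  := y :* (x :* z :- u :* w)) refl
                                     a (c′ j) (v (suc j) r) (v (suc j) r₀) (v zero r)) ⟩
      ∑[ j < m ] (c′ j * (a * v (suc j) r - v (suc j) r₀ * v zero r)) ∎
      where
      open ≡-Reasoning
      X-terms L-terms : Fin m → ℤ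
      X-terms j = c′ j * v (suc j) r
      L-terms j = c′ j * v (suc j) r₀
      X L : ℤ
      X = sum X-terms
      L = sum L-terms

    c·v≡0 : ∀ r → ∑[ i < suc m ] (c i * v i r) ≡ 0ℤ
    c·v≡0 r with r₀ ≟ r
    ... | yes refl = trans (combination r₀) (∑-0 (λ j → solve 3
                       (λ y x z → y :* (x :* z :- z :* x) := con 0ℤ) refl (c′ j) a (v (suc j) r₀)))
    ... | no r₀≢r  = trans (combination r)
                           (subst (λ t → ∑[ j < m ] (c′ j * (a * v (suc j) t - v (suc j) r₀ * v zero t)) ≡ 0ℤ)
                                  (punchIn-punchOut r₀≢r) (c′·v′≡0 (punchOut r₀≢r)))

  linearlyDependent : (v : Fin (suc n) → Fin n → ℤ) → LinearlyDependent v
  linearlyDependent {zero}  v = (λ _ → 1ℤ) , (zero , λ ()) , λ ()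
  linearlyDependent {suc n} v with all? (λ r → v zero r ZP.≟ 0ℤ)
  ... | yes v₀≡0 = c , (zero , λ ()) , c·v≡0
    where
    c : Fin (suc (suc n)) → ℤ
    c zero    = 1ℤ
    c (suc _) = 0ℤ
    c·v≡0 : ∀ r → ∑[ i < suc (suc n) ] (c i * v i r) ≡ 0ℤ
    c·v≡0 r = cong₂ _+_ (trans (ZP.*-identityˡ (v zero r)) (v₀≡0 r))
                        (∑-0 {f = λ j → 0ℤ * v (suc j) r} (λ _ → refl))
  ... | no ¬v₀≡0 with ¬∀⟶∃¬ _ _ (λ r → v zero r ZP.≟ 0ℤ) ¬v₀≡0
  ...   | r₀ , v₀r₀≢0 = dependent-by-pivot v r₀ v₀r₀≢0 (linearlyDependent (eliminate v r₀))

  module LehmanProduct {n : ℕ} (A B : Mat n) {K : ℤ} (K≢0 : K ≢ 0ℤ) (n+K≢0 : + n + K ≢ 0ℤ)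
                       (product : ∀ i j → + mulT A B i j ≡ JkI K i j) where

    product-ℤ : ∀ i j → ∑[ l < n ] (+ A i l * + B j l) ≡ JkI K i j
    product-ℤ i j = trans (sum-cong-≗ (λ l → sym (ZP.pos-* (A i l) (B j l))))
                          (trans (sym (+-sumFin (λ l → A i l ℕ.* B j l))) (product i j))

    Bℤ : Fin n → Fin n → ℤ
    Bℤ j l = + B j l

    -- y, B₀, …, Bₙ₋₁ are n + 1 vectors in ℤⁿ; applying A to a vanishing combination of them
    -- leaves a vanishing combination of the rows of J + kI, so only y can carry a coefficient.
    A-injective : (y : Fin n → ℤ) → (∀ r → ∑[ u < n ] (+ A r u * y u) ≡ 0ℤ) → ∀ u → y u ≡ 0ℤ
    A-injective y Ay≡0 u with linearlyDependent (y ∷ Bℤ)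
    ... | c , (i₀ , cᵢ₀≢0) , c·F≡0 = i≢0∧i*j≡0⇒j≡0 (c₀≢0 i₀ cᵢ₀≢0) c₀yᵤ≡0
      where
      F : Fin (suc n) → Fin n → ℤ
      F = y ∷ Bℤ

      cB≡0 : ∀ j → c (suc j) ≡ 0ℤ
      cB≡0 = JkI-nonsingular K≢0 n+K≢0 (c ∘ suc) λ r → begin
        ∑[ j < n ] (c (suc j) * JkI K r j)
          ≡⟨ sum-cong-≗ (λ j → cong (c (suc j) *_) (product-ℤ r j)) ⟨
        ∑[ j < n ] (c (suc j) * ∑[ l < n ] (+ A r l * Bℤ j l))
          ≡⟨ ZP.+-identityˡ _ ⟨
        0ℤ + ∑[ j < n ] (c (suc j) * ∑[ l < n ] (+ A r l * Bℤ j l))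
          ≡⟨ cong (_+ ∑[ j < n ] (c (suc j) * ∑[ l < n ] (+ A r l * Bℤ j l)))
                  (trans (cong (c zero *_) (Ay≡0 r)) (ZP.*-zeroʳ (c zero))) ⟨
        ∑[ i < suc n ] (c i * ∑[ l < n ] (+ A r l * F i l))
          ≡⟨ ∑-bilinear-comm c (λ l → + A r l) F ⟩
        ∑[ l < n ] (+ A r l * ∑[ i < suc n ] (c i * F i l))
          ≡⟨ ∑-0 (λ l → trans (cong (+ A r l *_) (c·F≡0 l)) (ZP.*-zeroʳ (+ A r l))) ⟩
        0ℤ ∎
        where open ≡-Reasoning

      c₀≢0 : ∀ i → c i ≢ 0ℤ → c zero ≢ 0ℤ
      c₀≢0 zero    cᵢ≢0 = cᵢ≢0
      c₀≢0 (suc j) cⱼ≢0 = contradiction (cB≡0 j) cⱼ≢0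

      c₀yᵤ≡0 : c zero * y u ≡ 0ℤ
      c₀yᵤ≡0 = trans (sym (ZP.+-identityʳ (c zero * y u)))
                     (trans (cong (_+_ (c zero * y u)) (sym (∑-0 (λ j → cong (_* Bℤ j u) (cB≡0 j)))))
                            (c·F≡0 u))

    -- Every row of Aᵀ B − (J + kI) is killed by A, because A J = J A = d J.
    transpose-product : {d : ℕ} → (∀ i → sumFin (A i) ≡ d) → (∀ j → sumFin (λ i → A i j) ≡ d) →
                        ∀ w u → + mulT (flip A) (flip B) w u ≡ JkI K w u
    transpose-product {d} row-sum col-sum w u = begin
      + mulT (flip A) (flip B) w u
        ≡⟨ +-sumFin (λ i → A i w ℕ.* B i u) ⟩
      ∑[ i < n ] (+ (A i w ℕ.* B i u))
        ≡⟨ sum-cong-≗ (λ i → ZP.pos-* (A i w) (B i u)) ⟩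
      T u
        ≡⟨ ZP.i-j≡0⇒i≡j (T u) (JkI K w u) (A-injective y Ay≡0 u) ⟩
      JkI K w u ∎
      where
      open ≡-Reasoning
      T y : Fin n → ℤ
      T v = ∑[ i < n ] (+ A i w * Bℤ i v)
      y v = T v - JkI K w v

      +d : ∀ {f : Fin n → ℕ} → sumFin f ≡ d → ∑[ i < n ] (+ f i) ≡ + d
      +d {f} Σf≡d = trans (sym (+-sumFin f)) (cong +_ Σf≡d)

      A·T : ∀ r → ∑[ v < n ] (+ A r v * T v) ≡ + d + K * + A r w
      A·T r = begin
        ∑[ v < n ] (+ A r v * T v)
          ≡⟨ ∑-bilinear-comm (λ i → + A i w) (λ v → + A r v) Bℤ ⟨
        ∑[ i < n ] (+ A i w * ∑[ v < n ] (+ A r v * Bℤ i v))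
          ≡⟨ sum-cong-≗ (λ i → cong (+ A i w *_) (product-ℤ r i)) ⟩
        ∑[ i < n ] (+ A i w * JkI K r i)
          ≡⟨ ∑-*JkI K r (λ i → + A i w) ⟩
        ∑[ i < n ] (+ A i w) + K * + A r w
          ≡⟨ cong (_+ K * + A r w) (+d (col-sum w)) ⟩
        + d + K * + A r w ∎

      A·J : ∀ r → ∑[ v < n ] (+ A r v * JkI K w v) ≡ + d + K * + A r w
      A·J r = trans (∑-*JkI K w (λ v → + A r v)) (cong (_+ K * + A r w) (+d (row-sum r)))

      *-distribˡ-- : ∀ a b c → a * (b - c) ≡ a * b - a * c
      *-distribˡ-- = solve 3 (λ a b c → a :* (b :- c) := a :* b :- a :* c) refl

      Ay≡0 : ∀ r → ∑[ v < n ] (+ A r v * y v) ≡ 0ℤ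
      Ay≡0 r = begin
        ∑[ v < n ] (+ A r v * y v)
          ≡⟨ sum-cong-≗ (λ v → *-distribˡ-- (+ A r v) (T v) (JkI K w v)) ⟩
        ∑[ v < n ] (+ A r v * T v - + A r v * JkI K w v)
          ≡⟨ ∑-sub (λ v → + A r v * T v) (λ v → + A r v * JkI K w v) ⟩
        ∑[ v < n ] (+ A r v * T v) - ∑[ v < n ] (+ A r v * JkI K w v)
          ≡⟨ cong₂ _-_ (A·T r) (A·J r) ⟩
        (+ d + K * + A r w) - (+ d + K * + A r w)
          ≡⟨ ZP.+-inverseʳ (+ d + K * + A r w) ⟩
        0ℤ ∎

  n+lehmanK : (n r s : ℕ) → + n + lehmanK n r s ≡ + (r ℕ.* s)
  n+lehmanK n r s = solve 2 (λ m t → m :+ (t :- m) := t) refl (+ n) (+ (r ℕ.* s))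

module LehmanGraphs where

  open FinSums
  open IntegerLinearAlgebra
  open import Data.Nat using (ℕ; _+_; _*_; _≤_; _<_; z≤n; s≤s)
  import Data.Nat.Properties as NP
  open import Data.Nat.Solver using (module +-*-Solver)
  open import Data.Fin using (Fin; _≟_)
  open import Data.Integer as ℤ using (ℤ; +_; 1ℤ; -1ℤ)
  import Data.Integer.Properties as ZP
  open import Data.List using (List; []; _∷_; length; map)
  import Data.Nat.ListAction as List
  open import Data.List.Membership.Propositional using (_∉_)
  open import Data.List.Relation.Unary.All as All using (All; []; _∷_)
  open import Data.List.Relation.Unary.Any using (here; there)
  open import Data.List.Relation.Unary.Unique.Propositional using (Unique; []; _∷_)
  open import Data.Product using (_×_; _,_; proj₁; proj₂; swap)
  open import Data.Sum using (_⊎_; inj₁; inj₂)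
  open import Data.Empty using (⊥-elim)
  open import Function using (_∘_; flip)
  open import Relation.Binary.PropositionalEquality
  open import Relation.Nullary using (¬_; yes; no)

  UnitK : ℕ → ℕ → Set
  UnitK n s = (lehmanK n 3 s ≡ -1ℤ × 1 < s) ⊎ (lehmanK n 3 s ≡ 1ℤ × 2 < s)

  shared-bit : ∀ {p₀ p₁ p₂ p} → p₀ ≤ 1 → p₁ ≤ 1 → p₂ ≤ 1 → p ≤ 1 →
               List.sum (p₀ ∷ p₁ ∷ p ∷ []) ≡ 1 → List.sum (p₀ ∷ p₁ ∷ p₂ ∷ []) ≡ 1 →
               List.sum (p₁ ∷ p₂ ∷ p ∷ []) ≡ 1 → p₁ ≡ 1
  shared-bit _         (s≤s z≤n) _         _         _  _  _  = refl
  shared-bit z≤n       z≤n       z≤n       z≤n       () _  _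
  shared-bit z≤n       z≤n       z≤n       (s≤s z≤n) _  () _
  shared-bit z≤n       z≤n       (s≤s z≤n) z≤n       () _  _
  shared-bit z≤n       z≤n       (s≤s z≤n) (s≤s z≤n) _  _  ()
  shared-bit (s≤s z≤n) z≤n       z≤n       z≤n       _  _  ()
  shared-bit (s≤s z≤n) z≤n       z≤n       (s≤s z≤n) () _  _
  shared-bit (s≤s z≤n) z≤n       (s≤s z≤n) z≤n       _  () _
  shared-bit (s≤s z≤n) z≤n       (s≤s z≤n) (s≤s z≤n) () _  _

  excluded-bit : ∀ {p₀ p₁ p₂ p} → p₀ ≤ 1 → p₁ ≤ 1 → p₂ ≤ 1 → p ≤ 1 →
                 List.sum (p₀ ∷ p₁ ∷ p ∷ []) ≢ 0 → List.sum (p₀ ∷ p₁ ∷ p₂ ∷ []) ≤ 1 →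
                 List.sum (p₂ ∷ p ∷ []) ≤ 1 → p₂ ≡ 0
  excluded-bit _         _         z≤n       _         _   _         _        = refl
  excluded-bit z≤n       z≤n       (s≤s z≤n) z≤n       ≢0  _         _        = ⊥-elim (≢0 refl)
  excluded-bit z≤n       z≤n       (s≤s z≤n) (s≤s z≤n) _   _         (s≤s ())
  excluded-bit z≤n       (s≤s z≤n) (s≤s z≤n) _         _   (s≤s ()) _
  excluded-bit (s≤s z≤n) z≤n       (s≤s z≤n) _         _   (s≤s ()) _
  excluded-bit (s≤s z≤n) (s≤s z≤n) (s≤s z≤n) _         _   (s≤s ()) _

  module Lehman {n r s : ℕ} {A : Mat n} (G : IsLehman n r s A) where
    open IsLehman G

    mulT-offDiagonal : {i j : Fin n} → i ≢ j → mulT A B i j ≡ 1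
    mulT-offDiagonal {i} {j} i≢j = ZP.+-injective (trans (product i j) (JkI-offDiagonal _ i≢j))

    mulT-diagonal : {k : ℤ} → lehmanK n r s ≡ k → (i : Fin n) → + mulT A B i i ≡ 1ℤ ℤ.+ k
    mulT-diagonal K≡k i = trans (product i i) (trans (JkI-diagonal _ i) (cong (ℤ._+_ 1ℤ) K≡k))

    mulT-≤1 : lehmanK n r s ≡ -1ℤ → ∀ i j → mulT A B i j ≤ 1
    mulT-≤1 K≡-1 i j with i ≟ j
    ... | yes refl = NP.≤-trans (NP.≤-reflexive (ZP.+-injective (mulT-diagonal K≡-1 i))) z≤n
    ... | no  i≢j  = NP.≤-reflexive (mulT-offDiagonal i≢j)

    mulT-≢0 : lehmanK n r s ≡ 1ℤ → ∀ i j → mulT A B i j ≢ 0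
    mulT-≢0 K≡1 i j with i ≟ j
    ... | yes refl = NP.1+n≢0 ∘ trans (sym (ZP.+-injective (mulT-diagonal K≡1 i)))
    ... | no  i≢j  = NP.1+n≢0 ∘ trans (sym (mulT-offDiagonal i≢j))

    mulT-neighbourhood : {i : Fin n} {xs : List (Fin n)} → Unique xs → All (Adj A i) xs →
                         length xs ≡ r → ∀ j → mulT A B i j ≡ List.sum (map (B j) xs)
    mulT-neighbourhood {i} xs! i~xs |xs|≡r j =
      sumFin-*-≡ xs! (All.map (NP.≤-reflexive ∘ sym) i~xs)
                     (NP.≤-reflexive (trans (proj₁ Areg i) (sym |xs|≡r))) (B j)

    mulT-≥-neighbours : {i : Fin n} {xs : List (Fin n)} → Unique xs → All (Adj A i) xs →
                        ∀ j → List.sum (map (B j) xs) ≤ mulT A B i j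
    mulT-≥-neighbours xs! i~xs j = sumFin-*-≥ xs! (All.map (NP.≤-reflexive ∘ sym) i~xs) (B j)

  module Cubic {n s : ℕ} {A : Mat n} (G : IsLehman n 3 s A) where
    open IsLehman G
    open Lehman G

    module _ {b0 b1 b2 w0 w1 w2 : Fin n} (L : Ladder3 A b0 b1 b2 w0 w1 w2)
             {wL : Fin n} (b0~wL : Adj A b0 wL) (wL∉L : Outside wL w0 w1 w2) where
      open Ladder3 L

      wL≢w0 : wL ≢ w0
      wL≢w0 = proj₁ wL∉L
      wL≢w1 : wL ≢ w1
      wL≢w1 = proj₁ (proj₂ wL∉L)
      wL≢w2 : wL ≢ w2
      wL≢w2 = proj₂ (proj₂ wL∉L)

      b0-row : ∀ j → mulT A B b0 j ≡ List.sum (B j w0 ∷ B j w1 ∷ B j wL ∷ [])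
      b0-row = mulT-neighbourhood ((w01 ∷ wL≢w0 ∘ sym ∷ []) ∷ (wL≢w1 ∘ sym ∷ []) ∷ [] ∷ [])
                                  (e00 ∷ e01 ∷ b0~wL ∷ []) refl

      b1-row : ∀ j → mulT A B b1 j ≡ List.sum (B j w0 ∷ B j w1 ∷ B j w2 ∷ [])
      b1-row = mulT-neighbourhood ((w01 ∷ w02 ∷ []) ∷ (w12 ∷ []) ∷ [] ∷ [])
                                  (e10 ∷ e11 ∷ e12 ∷ []) refl

      outer-distinct : s + 3 < n → {wR : Fin n} → Adj A b2 wR → wL ≢ wR
      outer-distinct s+3<n b2~wL refl = NP.<⇒≱ s+3<n n≤s+3
        where
        b2-row : ∀ j → mulT A B b2 j ≡ List.sum (B j w1 ∷ B j w2 ∷ B j wL ∷ [])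
        b2-row = mulT-neighbourhood ((w12 ∷ wL≢w1 ∘ sym ∷ []) ∷ (wL≢w2 ∘ sym ∷ []) ∷ [] ∷ [])
                                    (e21 ∷ e22 ∷ b2~wL ∷ []) refl

        w1-column : ∀ j → j ∉ b0 ∷ b1 ∷ b2 ∷ [] → 1 ≤ B j w1
        w1-column j j∉L = NP.≤-reflexive (sym (shared-bit (B01 j w0) (B01 j w1) (B01 j w2) (B01 j wL)
          (trans (sym (b0-row j)) (mulT-offDiagonal (j∉L ∘ here ∘ sym)))
          (trans (sym (b1-row j)) (mulT-offDiagonal (j∉L ∘ there ∘ here ∘ sym)))
          (trans (sym (b2-row j)) (mulT-offDiagonal (j∉L ∘ there ∘ there ∘ here ∘ sym)))))

        n≤s+3 : n ≤ s + 3
        n≤s+3 = subst (λ t → n ≤ t + 3) (proj₂ Breg w1)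
                      (≤-sumFin+length (b0 ∷ b1 ∷ b2 ∷ []) w1-column)

      w2-vanishes : {bR : Fin n} → Adj A bR w2 → Adj A bR wL → ∀ j →
                    mulT A B b0 j ≢ 0 → mulT A B b1 j ≤ 1 → mulT A B bR j ≤ 1 → B j w2 ≡ 0
      w2-vanishes bR~w2 bR~wL j b0j≢0 b1j≤1 bRj≤1 =
        excluded-bit (B01 j w0) (B01 j w1) (B01 j w2) (B01 j wL)
          (b0j≢0 ∘ trans (b0-row j))
          (subst (_≤ 1) (b1-row j) b1j≤1)
          (NP.≤-trans (mulT-≥-neighbours ((wL≢w2 ∘ sym ∷ []) ∷ [] ∷ []) (bR~w2 ∷ bR~wL ∷ []) j) bRj≤1)

      w2-column-≤ : (xs : List (Fin n)) → (∀ j → j ∉ xs → B j w2 ≡ 0) → s ≤ length xs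
      w2-column-≤ xs vanishes =
        subst (_≤ length xs) (proj₂ Breg w2) (sumFin-≤-length xs (λ j → B01 j w2) vanishes)

      outer-nonadjacent : UnitK n s → {bR : Fin n} → Adj A bR w2 → ¬ Adj A bR wL
      outer-nonadjacent (inj₁ (K≡-1 , 1<s)) {bR} bR~w2 bR~wL =
        NP.<⇒≱ 1<s (w2-column-≤ (b0 ∷ []) λ j j∉b0 →
          w2-vanishes bR~w2 bR~wL j (NP.1+n≢0 ∘ trans (sym (mulT-offDiagonal (j∉b0 ∘ here ∘ sym))))
                                    (mulT-≤1 K≡-1 b1 j) (mulT-≤1 K≡-1 bR j))
      outer-nonadjacent (inj₂ (K≡1 , 2<s)) {bR} bR~w2 bR~wL =
        NP.<⇒≱ 2<s (w2-column-≤ (b1 ∷ bR ∷ []) λ j j∉b1bR →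
          w2-vanishes bR~w2 bR~wL j (mulT-≢0 K≡1 b0 j)
                                    (NP.≤-reflexive (mulT-offDiagonal (j∉b1bR ∘ here ∘ sym)))
                                    (NP.≤-reflexive (mulT-offDiagonal (j∉b1bR ∘ there ∘ here ∘ sym))))

  IsLehman-flip : {n r s : ℕ} {A : Mat n} → r * s ≢ 0 → IsLehman n r s A → IsLehman n r s (flip A)
  IsLehman-flip {n} {r} {s} {A} rs≢0 G = record
    { A01     = flip A01
    ; Areg    = swap Areg
    ; B       = flip B
    ; B01     = flip B01
    ; Breg    = swap Breg
    ; kAdm    = kAdm
    ; product = LehmanProduct.transpose-product A B (proj₂ kAdm) n+K≢0 product (proj₁ Areg) (proj₂ Areg)
    }
    where
    open IsLehman G
    n+K≢0 : + n ℤ.+ lehmanK n r s ≢ ℤ.0ℤ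
    n+K≢0 n+K≡0 = rs≢0 (ZP.+-injective (trans (sym (n+lehmanK n r s)) n+K≡0))

  Ladder3-flip : {n : ℕ} {A : Mat n} {b0 b1 b2 w0 w1 w2 : Fin n} →
                 Ladder3 A b0 b1 b2 w0 w1 w2 → Ladder3 (flip A) w0 w1 w2 b0 b1 b2
  Ladder3-flip L = record
    { b01 = w01 ; b02 = w02 ; b12 = w12 ; w01 = b01 ; w02 = b02 ; w12 = b12
    ; e00 = e00 ; e11 = e11 ; e22 = e22 ; e01 = e10 ; e21 = e12 ; e10 = e01 ; e12 = e21
    ; n02 = n20 ; n20 = n02 }
    where open Ladder3 L

  module _ {n s : ℕ} where
    open +-*-Solver
    open NP.≤-Reasoning

    s+3<n : UnitK n s → s + 3 < n
    s+3<n (inj₁ (K≡-1 , 1<s)) = begin-strict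
      s + 3           ≡⟨ solve 1 (λ s → s :+ con 3 := s :+ con 1 :+ con 2) refl s ⟩
      s + 1 + 2       <⟨ NP.+-monoʳ-< (s + 1) (NP.<-≤-trans 2<4 (NP.*-monoʳ-≤ 2 1<s)) ⟩
      s + 1 + 2 * s   ≡⟨ solve 1 (λ s → s :+ con 1 :+ con 2 :* s := con 3 :* s :+ con 1) refl s ⟩
      3 * s + 1       ≡⟨ ZP.+-injective n≡3s+1 ⟨
      n               ∎
      where
      2<4 : 2 < 4
      2<4 = NP.m≤n⇒m≤1+n NP.≤-refl
      n≡3s+1 : + n ≡ + (3 * s) ℤ.+ 1ℤ
      n≡3s+1 = trans (sym (trans (ZP.+-assoc (+ n) -1ℤ 1ℤ) (ZP.+-identityʳ (+ n))))
                     (cong (ℤ._+ 1ℤ) (trans (cong (ℤ._+_ (+ n)) (sym K≡-1)) (n+lehmanK n 3 s)))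
    s+3<n (inj₂ (K≡1 , 2<s)) = NP.+-cancelʳ-< 1 (s + 3) n (begin-strict
      s + 3 + 1       ≡⟨ solve 1 (λ s → s :+ con 3 :+ con 1 := s :+ con 4) refl s ⟩
      s + 4           <⟨ NP.+-monoʳ-< s (NP.<-≤-trans 4<6 (NP.*-monoʳ-≤ 2 2<s)) ⟩
      s + 2 * s       ≡⟨ solve 1 (λ s → s :+ con 2 :* s := con 3 :* s) refl s ⟩
      3 * s           ≡⟨ ZP.+-injective (trans (cong (ℤ._+_ (+ n)) (sym K≡1)) (n+lehmanK n 3 s)) ⟨
      n + 1           ∎)
      where
      4<6 : 4 < 6
      4<6 = NP.m≤n⇒m≤1+n NP.≤-refl

    3s≢0 : UnitK n s → 3 * s ≢ 0
    3s≢0 unit = NP.>⇒≢ (NP.<-≤-trans (0<s unit) (NP.m≤n*m s 3))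
      where
      0<s : UnitK n s → 0 < s
      0<s (inj₁ (_ , 1<s)) = NP.≤-trans (s≤s z≤n) 1<s
      0<s (inj₂ (_ , 2<s)) = NP.≤-trans (s≤s z≤n) 2<s

open LehmanGraphs

lemma3p1 : (n s : ℕ) (A : Mat n) → IsLehman n 3 s A →
  ((lehmanK n 3 s ≡ ℤ.-1ℤ × 1 < s) ⊎ (lehmanK n 3 s ≡ ℤ.1ℤ × 2 < s)) →
  (b0 b1 b2 w0 w1 w2 : Fin n) → Ladder3 A b0 b1 b2 w0 w1 w2 →
  (wL bL wR bR : Fin n) →
  Adj A b0 wL → Outside wL w0 w1 w2 →
  Adj A bL w0 → Outside bL b0 b1 b2 →
  Adj A b2 wR → Outside wR w0 w1 w2 →
  Adj A bR w2 → Outside bR b0 b1 b2 →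
  (bL ≢ bR) × (wL ≢ wR) × ¬ Adj A bR wL × ¬ Adj A bL wR
lemma3p1 n s A G unit b0 b1 b2 w0 w1 w2 L wL bL wR bR b0~wL wL∉L bL~w0 bL∉L b2~wR _ bR~w2 _ =
  Cubic.outer-distinct    Gᵀ Lᵀ bL~w0 bL∉L (s+3<n {n} unit) bR~w2 ,
  Cubic.outer-distinct    G  L  b0~wL wL∉L (s+3<n {n} unit) b2~wR ,
  Cubic.outer-nonadjacent G  L  b0~wL wL∉L unit bR~w2 ,
  Cubic.outer-nonadjacent Gᵀ Lᵀ bL~w0 bL∉L unit b2~wR
  where
  Gᵀ : IsLehman n 3 s (flip A)
  Gᵀ = IsLehman-flip (3s≢0 {n} unit) G
  Lᵀ : Ladder3 (flip A) w0 w1 w2 b0 b1 b2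
  Lᵀ = Ladder3-flip L
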